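{- In $\mathbf{IPF}^I$, for all formulas $F,G$ and variable $x$: $Ix[F,G],\ Ix[F,\exists!x]\vdash\exists xG$.
   Context: $\mathbf{IPF}$ is a natural deduction system of intuitionist positive free logic: a first-order language without function symbols, terms constants and parameters, primitive predicate $\exists!$ ("exists"), identity; standard intuitionist rules for $\land,\rightarrow,\lor,\leftrightarrow$, $\bot E$ to atomic conclusions; $\forall I$ (infer $\forall xA$ from a deduction of $A^x_a$, discharging $\exists!a$, $a$ fresh), $\forall E$ (from $\forall xA$, $\exists!t$ infer $A^x_t$), $\exists I$ (from $A^x_t$, $\exists!t$ infer $\exists xA$), $\exists E$ (from $\exists xA$ and a deduction of $C$ from $A^x_a,\exists!a$ infer $C$, discharging them, $a$ fresh); $=I$: axiom $t=t$; $=E$: from $t_1=t_2$ and $A^x_{t_1}$ infer $A^x_{t_2}$ ($A$ atomic). $\mathbf{IPF}^I$ adds formulas $Ix[F,G]$ ("the $F$ is $G$", binding $x$) with rules ($a,b$ fresh parameters not occurring in $F,G,C$ or other open assumptions of the subdeduction, $a\neq t$): $II$: from $F^x_t,G^x_t,\exists!t$ and a deduction of $a=t$ from $F^x_a,\exists!a$ (discharged) infer $Ix[F,G]$; $IE^{1p}$: from $Ix[F,G]$, $F^x_t$, $\exists!t$, a deduction of $a=t$ from $F^x_a,\exists!a$ and a deduction of $C$ from $F^x_b,G^x_b,\exists!b$ (all discharged) infer $C$; $IE^{2p}$: from $Ix[F,\exists!x],\exists!t_1,\exists!t_2,F^x_{t_1},F^x_{t_2},A^x_{t_1}$ infer $A^x_{t_2}$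 ($A$ atomic); $IE^{3p}$: from $Ix[F,\exists!x]$ and a deduction of $C$ from $F^x_a,\exists!a$ (discharged) infer $C$; $IE^{4p}$: from $Ix[F,x=t_2],\exists!t_1,\exists!t_2,F^x_{t_1},A^x_{t_1}$ infer $A^x_{t_2}$ ($A$ atomic); $IE^{5p}$: from $Ix[F,x=t],\exists!t$ and a deduction of $C$ from $F^x_a,\exists!a$ (discharged) infer $C$. -}

module Defs where

open import Data.Nat using (ℕ; _≡ᵇ_)
open import Data.Bool using (if_then_else_)
open import Data.List using (List; []; _∷_; _++_)
open import Data.List.Membership.Propositional using (_∈_)
open import Data.List.Relation.Unary.All using (All)
open import Relation.Binary.PropositionalEquality using (_≡_)
open import Relation.Nullary using (¬_)

-- Terms occurring in the rules
-- (the t, t₁, t₂ of the rules) are closed: constants or parameters.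

data CTerm : Set where
  par : ℕ → CTerm
  con : ℕ → CTerm

data Term : Set where
  var : ℕ → Term
  ct  : CTerm → Term

infixr 6 _∧'_
infixr 5 _∨'_
infixr 4 _⇒_ _⇔_
infix  7 _≐_

data Formula : Set where
  pred  : ℕ → List Term → Formula
  E!    : Term → Formula
  _≐_   : Term → Term → Formula
  ⊥'    : Formula
  _∧'_  : Formula → Formula → Formula
  _∨'_  : Formula → Formula → Formula
  _⇒_   : Formula → Formula → Formula
  _⇔_   : Formula → Formula → Formula
  ∀'    : ℕ → Formula → Formula
  ∃'    : ℕ → Formula → Formula
  I     : ℕ → Formula → Formula → Formula -- Ix[F,G] (x bound in F and G)

data Atomic : Formula → Set where
  at-pred : ∀ P ts → Atomic (pred P ts)
  at-E!   : ∀ t → Atomic (E! t)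
  at-≐    : ∀ s t → Atomic (s ≐ t)

-- Substitution A^x_t of a closed term t for the free occurrences of x.
-- (t is closed, so no capture can occur.)

substT : Term → ℕ → CTerm → Term
substT (var y) x t = if y ≡ᵇ x then ct t else var y
substT (ct c)  x t = ct c

substTs : List Term → ℕ → CTerm → List Term
substTs []       x t = []
substTs (s ∷ ss) x t = substT s x t ∷ substTs ss x t

_[_≔_] : Formula → ℕ → CTerm → Formula
pred P ts [ x ≔ t ] = pred P (substTs ts x t)
E! s      [ x ≔ t ] = E! (substT s x t)
(s ≐ u)   [ x ≔ t ] = substT s x t ≐ substT u x t
⊥'        [ x ≔ t ] = ⊥'
(A ∧' B)  [ x ≔ t ] = (A [ x ≔ t ]) ∧' (B [ x ≔ t ])
(A ∨' B)  [ x ≔ t ] = (A [ x ≔ t ]) ∨' (B [ x ≔ t ])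
(A ⇒ B)   [ x ≔ t ] = (A [ x ≔ t ]) ⇒ (B [ x ≔ t ])
(A ⇔ B)   [ x ≔ t ] = (A [ x ≔ t ]) ⇔ (B [ x ≔ t ])
∀' y A    [ x ≔ t ] = if y ≡ᵇ x then ∀' y A else ∀' y (A [ x ≔ t ])
∃' y A    [ x ≔ t ] = if y ≡ᵇ x then ∃' y A else ∃' y (A [ x ≔ t ])
I y F G   [ x ≔ t ] = if y ≡ᵇ x then I y F G
                      else I y (F [ x ≔ t ]) (G [ x ≔ t ])

parsT : Term → List ℕ
parsT (var _)       = []
parsT (ct (par a))  = a ∷ []
parsT (ct (con _))  = []

parsTs : List Term → List ℕ
parsTs []       = []
parsTs (s ∷ ss) = parsT s ++ parsTs ss

pars : Formula → List ℕ
pars (pred _ ts) = parsTs ts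
pars (E! s)      = parsT s
pars (s ≐ u)     = parsT s ++ parsT u
pars ⊥'          = []
pars (A ∧' B)    = pars A ++ pars B
pars (A ∨' B)    = pars A ++ pars B
pars (A ⇒ B)     = pars A ++ pars B
pars (A ⇔ B)     = pars A ++ pars B
pars (∀' _ A)    = pars A
pars (∃' _ A)    = pars A
pars (I _ F G)   = pars F ++ pars G

_#_ : ℕ → Formula → Set
a # A = ¬ (a ∈ pars A)

_#*_ : ℕ → List Formula → Set
a #* Γ = All (λ A → a # A) Γ

-- Derivability in IPF^I, as natural deduction in sequent style:
-- Γ ⊢ A means A is deducible with open assumptions among Γ.
-- Discharged assumptions are added to the context of the subdeduction.

infix 2 _⊢_

data _⊢_ (Γ : List Formula) : Formula → Set where
  ass  : ∀ {A} → A ∈ Γ → Γ ⊢ A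
  ∧I   : ∀ {A B} → Γ ⊢ A → Γ ⊢ B → Γ ⊢ A ∧' B
  ∧E₁  : ∀ {A B} → Γ ⊢ A ∧' B → Γ ⊢ A
  ∧E₂  : ∀ {A B} → Γ ⊢ A ∧' B → Γ ⊢ B
  ⇒I   : ∀ {A B} → (A ∷ Γ) ⊢ B → Γ ⊢ A ⇒ B
  ⇒E   : ∀ {A B} → Γ ⊢ A ⇒ B → Γ ⊢ A → Γ ⊢ B
  ∨I₁  : ∀ {A B} → Γ ⊢ A → Γ ⊢ A ∨' B
  ∨I₂  : ∀ {A B} → Γ ⊢ B → Γ ⊢ A ∨' B
  ∨E   : ∀ {A B C} → Γ ⊢ A ∨' B → (A ∷ Γ) ⊢ C → (B ∷ Γ) ⊢ C → Γ ⊢ C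
  ⇔I   : ∀ {A B} → (A ∷ Γ) ⊢ B → (B ∷ Γ) ⊢ A → Γ ⊢ A ⇔ B
  ⇔E₁  : ∀ {A B} → Γ ⊢ A ⇔ B → Γ ⊢ A → Γ ⊢ B
  ⇔E₂  : ∀ {A B} → Γ ⊢ A ⇔ B → Γ ⊢ B → Γ ⊢ A
  ⊥E   : ∀ {A} → Atomic A → Γ ⊢ ⊥' → Γ ⊢ A
  ∀I   : ∀ {x A} (a : ℕ) → a # ∀' x A → a #* Γ →
         (E! (ct (par a)) ∷ Γ) ⊢ A [ x ≔ par a ] → Γ ⊢ ∀' x A
  ∀E   : ∀ {x A} (t : CTerm) → Γ ⊢ ∀' x A → Γ ⊢ E! (ct t) → Γ ⊢ A [ x ≔ t ]
  ∃I   : ∀ {x A} (t : CTerm) → Γ ⊢ A [ x ≔ t ] → Γ ⊢ E! (ct t) → Γ ⊢ ∃' x A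
  ∃E   : ∀ {x A C} (a : ℕ) → a # ∃' x A → a # C → a #* Γ →
         Γ ⊢ ∃' x A →
         (A [ x ≔ par a ] ∷ E! (ct (par a)) ∷ Γ) ⊢ C → Γ ⊢ C
  ≐I   : ∀ (t : CTerm) → Γ ⊢ ct t ≐ ct t
  ≐E   : ∀ {x A} (t₁ t₂ : CTerm) → Atomic A →
         Γ ⊢ ct t₁ ≐ ct t₂ → Γ ⊢ A [ x ≔ t₁ ] → Γ ⊢ A [ x ≔ t₂ ]
  II   : ∀ {x F G} (t : CTerm) (a : ℕ) →
         a # F → a # G → a #* Γ → ¬ (par a ≡ t) →
         Γ ⊢ F [ x ≔ t ] → Γ ⊢ G [ x ≔ t ] → Γ ⊢ E! (ct t) →
         (F [ x ≔ par a ] ∷ E! (ct (par a)) ∷ Γ) ⊢ ct (par a) ≐ ct t →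
         Γ ⊢ I x F G
  IE1p : ∀ {x F G C} (t : CTerm) (a b : ℕ) →
         a # F → a # G → a # C → a #* Γ → ¬ (par a ≡ t) →
         b # F → b # G → b # C → b #* Γ →
         Γ ⊢ I x F G → Γ ⊢ F [ x ≔ t ] → Γ ⊢ E! (ct t) →
         (F [ x ≔ par a ] ∷ E! (ct (par a)) ∷ Γ) ⊢ ct (par a) ≐ ct t →
         (F [ x ≔ par b ] ∷ G [ x ≔ par b ] ∷ E! (ct (par b)) ∷ Γ) ⊢ C →
         Γ ⊢ C
  IE2p : ∀ {x F A} (t₁ t₂ : CTerm) → Atomic A →
         Γ ⊢ I x F (E! (var x)) → Γ ⊢ E! (ct t₁) → Γ ⊢ E! (ct t₂) →
         Γ ⊢ F [ x ≔ t₁ ] → Γ ⊢ F [ x ≔ t₂ ] → Γ ⊢ A [ x ≔ t₁ ] →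
         Γ ⊢ A [ x ≔ t₂ ]
  IE3p : ∀ {x F C} (a : ℕ) → a # F → a # C → a #* Γ →
         Γ ⊢ I x F (E! (var x)) →
         (F [ x ≔ par a ] ∷ E! (ct (par a)) ∷ Γ) ⊢ C → Γ ⊢ C
  IE4p : ∀ {x F A} (t₁ t₂ : CTerm) → Atomic A →
         Γ ⊢ I x F (var x ≐ ct t₂) → Γ ⊢ E! (ct t₁) → Γ ⊢ E! (ct t₂) →
         Γ ⊢ F [ x ≔ t₁ ] → Γ ⊢ A [ x ≔ t₁ ] → Γ ⊢ A [ x ≔ t₂ ]
  IE5p : ∀ {x F C} (t : CTerm) (a : ℕ) →
         a # F → a # C → a #* Γ → ¬ (par a ≡ t) →
         Γ ⊢ I x F (var x ≐ ct t) → Γ ⊢ E! (ct t) →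
         (F [ x ≔ par a ] ∷ E! (ct (par a)) ∷ Γ) ⊢ C → Γ ⊢ C

{-# OPTIONS --safe #-}
module Submission where

open import Defs
open import Data.Nat using (ℕ; suc; _≡ᵇ_; _≤_; _<_; s≤s)
open import Data.Nat.Properties using (≡⇒≡ᵇ; ≤-trans; ≤-refl; n≤1+n; <-irrefl)
open import Data.List using ([]; _∷_; _++_)
open import Data.List.Extrema.Nat using (max; xs≤max)
open import Data.List.Membership.Propositional using (_∈_)
open import Data.List.Membership.Propositional.Properties using (∈-++⁻; ∈-++⁺ˡ; ∈-++⁺ʳ)
open import Data.List.Relation.Unary.Any using (here; there)
open import Data.List.Relation.Unary.All as All using (All; []; _∷_)
open import Data.Bool using (true; false)
open import Data.Product using (_×_; _,_; proj₁; proj₂)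
open import Data.Sum using (_⊎_; inj₁; inj₂; [_,_]′; map₂)
open import Function using (_∘_)
open import Relation.Binary.PropositionalEquality using (_≡_; refl; sym; cong; subst)
open import Relation.Nullary using (¬_)

-- Ix[F,∃!x] provides an a with F(a) and ∃!a (IE³ᵖ). Applying IE²ᵖ to the atom
-- x = a shows that every existing b with F(b) satisfies b = a: this is the
-- uniqueness premise of IE¹ᵖ for Ix[F,G] at a, whose remaining subdeduction
-- gets ∃xG from the G-witness by ∃I.

substT-var-self : ∀ x t → substT (var x) x t ≡ ct t
substT-var-self x t with x ≡ᵇ x | ≡⇒≡ᵇ x x refl
... | true  | _ = refl
... | false | ()

∈-++-map₂ : ∀ {P : Set} {p : ℕ} xs {ys} xs′ {ys′} →
            (p ∈ xs → P ⊎ p ∈ xs′) → (p ∈ ys → P ⊎ p ∈ ys′) →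
            p ∈ xs ++ ys → P ⊎ p ∈ xs′ ++ ys′
∈-++-map₂ xs xs′ f g =
  [ map₂ ∈-++⁺ˡ ∘ f , map₂ (∈-++⁺ʳ xs′) ∘ g ]′ ∘ ∈-++⁻ xs

pars-substT : ∀ s x t {p} → p ∈ parsT (substT s x t) → p ∈ parsT (ct t) ⊎ p ∈ parsT s
pars-substT (var y) x t with y ≡ᵇ x
... | true  = inj₁
... | false = inj₂
pars-substT (ct c)  x t = inj₂

pars-substTs : ∀ ss x t {p} → p ∈ parsTs (substTs ss x t) → p ∈ parsT (ct t) ⊎ p ∈ parsTs ss
pars-substTs []       x t ()
pars-substTs (s ∷ ss) x t =
  ∈-++-map₂ (parsT (substT s x t)) (parsT s) (pars-substT s x t) (pars-substTs ss x t)

pars-subst : ∀ A x t {p} → p ∈ pars (A [ x ≔ t ]) → p ∈ parsT (ct t) ⊎ p ∈ pars A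
pars-subst₂ : ∀ A B x t {p} → p ∈ pars (A [ x ≔ t ]) ++ pars (B [ x ≔ t ]) →
              p ∈ parsT (ct t) ⊎ p ∈ pars A ++ pars B
pars-subst₂ A B x t = ∈-++-map₂ (pars (A [ x ≔ t ])) (pars A) (pars-subst A x t) (pars-subst B x t)

pars-subst (pred P ts) x t = pars-substTs ts x t
pars-subst (E! s)      x t = pars-substT s x t
pars-subst (s ≐ u)     x t =
  ∈-++-map₂ (parsT (substT s x t)) (parsT s) (pars-substT s x t) (pars-substT u x t)
pars-subst ⊥'          x t ()
pars-subst (A ∧' B)    x t = pars-subst₂ A B x t
pars-subst (A ∨' B)    x t = pars-subst₂ A B x t
pars-subst (A ⇒ B)     x t = pars-subst₂ A B x t
pars-subst (A ⇔ B)     x t = pars-subst₂ A B x t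
pars-subst (∀' y A)    x t with y ≡ᵇ x
... | true  = inj₂
... | false = pars-subst A x t
pars-subst (∃' y A)    x t with y ≡ᵇ x
... | true  = inj₂
... | false = pars-subst A x t
pars-subst (I y A B)   x t with y ≡ᵇ x
... | true  = inj₂
... | false = pars-subst₂ A B x t

ParsBelow : ℕ → Formula → Set
ParsBelow n A = ∀ {p} → p ∈ pars A → p < n

parsBelow⇒# : ∀ {n a} A → ParsBelow n A → n ≤ a → a # A
parsBelow⇒# A below n≤a a∈A = <-irrefl refl (≤-trans (below a∈A) n≤a)

parsBelow⇒#* : ∀ {n a Γ} → All (ParsBelow n) Γ → n ≤ a → a #* Γ
parsBelow⇒#* {Γ = []}    []               n≤a = []
parsBelow⇒#* {Γ = A ∷ Γ} (below ∷ belows) n≤a = parsBelow⇒# A below n≤a ∷ parsBelow⇒#* belows n≤a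

parsBelow-mono : ∀ {m n} A → m ≤ n → ParsBelow m A → ParsBelow n A
parsBelow-mono A m≤n below = λ p∈A → ≤-trans (below p∈A) m≤n

parsBelow-subst : ∀ {n a} A x → ParsBelow n A → a < n → ParsBelow n (A [ x ≔ par a ])
parsBelow-subst {a = a} A x below a<n =
  [ (λ { (here refl) → a<n }) , below ]′ ∘ pars-subst A x (par a)

parsBelow-I : ∀ {n} y F G → ParsBelow n F → ParsBelow n G → ParsBelow n (I y F G)
parsBelow-I y F G belowF belowG = [ belowF , belowG ]′ ∘ ∈-++⁻ (pars F)

parsBelow-I⁻ : ∀ {n} y F G → ParsBelow n (I y F G) → ParsBelow n F × ParsBelow n G
parsBelow-I⁻ y F G below = below ∘ ∈-++⁺ˡ , below ∘ ∈-++⁺ʳ (pars F)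

parsBound : Formula → ℕ
parsBound A = suc (max 0 (pars A))

parsBelow-parsBound : ∀ A → ParsBelow (parsBound A) A
parsBelow-parsBound A p∈A = s≤s (All.lookup (xs≤max 0 (pars A)) p∈A)

E!-description-unique : ∀ {Γ x F} s t →
  Γ ⊢ I x F (E! (var x)) → Γ ⊢ E! (ct t) → Γ ⊢ E! (ct s) →
  Γ ⊢ F [ x ≔ t ] → Γ ⊢ F [ x ≔ s ] → Γ ⊢ ct s ≐ ct t
E!-description-unique {Γ} {x} s t IFE E!t E!s Ft Fs =
  subst (Γ ⊢_) (cong (_≐ ct t) (substT-var-self x s))
    (IE2p {A = var x ≐ ct t} t s (at-≐ _ _) IFE E!t E!s Ft Fs
      (subst (Γ ⊢_) (cong (_≐ ct t) (sym (substT-var-self x t))) (≐I t)))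

-- Both parameters discharged by IE¹ᵖ can be n: each need only be fresh for its own subdeduction.
∃-of-description : ∀ {Γ x F G t} n → All (ParsBelow n) Γ →
  I x F G ∈ Γ → I x F (E! (var x)) ∈ Γ → F [ x ≔ t ] ∈ Γ → E! (ct t) ∈ Γ →
  Γ ⊢ ∃' x G
∃-of-description {Γ} {x} {F} {G} {t} n belowΓ IFG∈ IFE∈ Ft∈ E!t∈ =
  IE1p t n n n#F n#G n#G n#Γ n≢t n#F n#G n#G n#Γ
    (ass IFG∈) (ass Ft∈) (ass E!t∈)
    (E!-description-unique (par n) t (ass (there (there IFE∈))) (ass (there (there E!t∈)))
      (ass (there (here refl))) (ass (there (there Ft∈))) (ass (here refl)))
    (∃I (par n) (ass (there (here refl))) (ass (there (there (here refl)))))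
  where
  belowFG : ParsBelow n F × ParsBelow n G
  belowFG = parsBelow-I⁻ x F G (All.lookup belowΓ IFG∈)
  n#F : n # F
  n#F = parsBelow⇒# F (proj₁ belowFG) ≤-refl
  n#G : n # G
  n#G = parsBelow⇒# G (proj₂ belowFG) ≤-refl
  n#Γ : n #* Γ
  n#Γ = parsBelow⇒#* belowΓ ≤-refl
  n≢t : ¬ par n ≡ t
  n≢t refl = <-irrefl refl (All.lookup belowΓ E!t∈ (here refl))

mainTheorem16 : (F G : Formula) (x : ℕ) →
    (I x F G ∷ I x F (E! (var x)) ∷ []) ⊢ ∃' x G
mainTheorem16 F G x =
  IE3p n (parsBelow⇒# F belowF ≤-refl) (parsBelow⇒# G belowG ≤-refl)
    (parsBelow⇒#* belowΓ ≤-refl) (ass (there (here refl)))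
    (∃-of-description (suc n) belowΓ′
      (there (there (here refl))) (there (there (there (here refl))))
      (here refl) (there (here refl)))
  where
  n : ℕ
  n = parsBound (I x F G)
  belowF : ParsBelow n F
  belowF = proj₁ (parsBelow-I⁻ x F G (parsBelow-parsBound (I x F G)))
  belowG : ParsBelow n G
  belowG = proj₂ (parsBelow-I⁻ x F G (parsBelow-parsBound (I x F G)))
  belowIFE : ParsBelow n (I x F (E! (var x)))
  belowIFE = parsBelow-I x F (E! (var x)) belowF (λ ())
  belowΓ : All (ParsBelow n) (I x F G ∷ I x F (E! (var x)) ∷ [])
  belowΓ = parsBelow-parsBound (I x F G) ∷ belowIFE ∷ []
  belowΓ′ : All (ParsBelow (suc n)) (F [ x ≔ par n ] ∷ E! (ct (par n)) ∷ I x F G ∷ I x F (E! (var x)) ∷ [])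
  belowΓ′ = parsBelow-subst F x (parsBelow-mono F (n≤1+n n) belowF) ≤-refl
          ∷ (λ { (here refl) → ≤-refl })
          ∷ parsBelow-mono (I x F G) (n≤1+n n) (parsBelow-parsBound (I x F G))
          ∷ parsBelow-mono (I x F (E! (var x))) (n≤1+n n) belowIFE
          ∷ []
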